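{- Let $G$ be a finite group, and let $k$ be a number such that the intersection of any two distinct maximal cyclic subgroups of $G$ has cardinality $k$. Then $\mathcal{P}_e(G)$ is a chordal graph and a cograph.
   Context: For a finite group $G$, the enhanced power graph $\mathcal{P}_e(G)$ is the simple graph with vertex set $G$ in which two distinct vertices $x,y$ are adjacent if and only if $\langle x,y\rangle$ is cyclic. A maximal cyclic subgroup is a cyclic subgroup not properly contained in another cyclic subgroup. A graph is chordal if it has no induced cycle of length greater than $3$; it is a cograph if it has no induced subgraph isomorphic to the path $P_4$ on four vertices. -}

module Defs where

open import Data.Nat using (ℕ; zero; suc; _+_; _%_)
open import Data.Integer using (ℤ; +_; -[1+_])
open import Data.Fin using (Fin; toℕ)
open import Data.List using (List; length)
open import Data.List.Membership.Propositional using (_∈_)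
open import Data.List.Relation.Unary.Unique.Propositional using (Unique)
open import Data.Product using (Σ; ∃; _×_; _,_)
open import Data.Sum using (_⊎_)
open import Relation.Nullary using (¬_)
open import Relation.Binary.PropositionalEquality using (_≡_; _≢_)
open import Function.Bundles using (_⇔_)
open import Function.Definitions using (Injective)
open import Algebra.Structures using (IsGroup)

-- A finite group, presented (up to isomorphism) on the carrier Fin order,
-- with propositional equality as the group's equality.
record FiniteGroup : Set where
  field
    order : ℕ
    _∙_   : Fin order → Fin order → Fin order
    e     : Fin order
    _⁻¹   : Fin order → Fin order
    isGroup : IsGroup _≡_ _∙_ e _⁻¹

module _ (G : FiniteGroup) where
  open FiniteGroup G

  Elt : Set
  Elt = Fin order

  powℕ : Elt → ℕ → Elt
  powℕ z zero    = e
  powℕ z (suc m) = z ∙ powℕ z m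

  pow : Elt → ℤ → Elt
  pow z (+ m)     = powℕ z m
  pow z -[1+ m ]  = (powℕ z (suc m)) ⁻¹

  InCyc : Elt → Elt → Set
  InCyc z g = ∃ λ (m : ℤ) → g ≡ pow z m

  data InGen2 (x y : Elt) : Elt → Set where
    gen-e   : InGen2 x y e
    gen-x   : InGen2 x y x
    gen-y   : InGen2 x y y
    gen-inv : ∀ {g} → InGen2 x y g → InGen2 x y (g ⁻¹)
    gen-mul : ∀ {g h} → InGen2 x y g → InGen2 x y h → InGen2 x y (g ∙ h)

  Gen2Cyclic : Elt → Elt → Set
  Gen2Cyclic x y = ∃ λ z → ∀ g → InGen2 x y g ⇔ InCyc z g

  -- enhanced power graph adjacency
  Adj : Elt → Elt → Set
  Adj x y = x ≢ y × Gen2Cyclic x y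

  MaxCyclic : Elt → Set
  MaxCyclic z = ∀ w → (∀ g → InCyc z g → InCyc w g) → (∀ g → InCyc w g → InCyc z g)

  SameCyc : Elt → Elt → Set
  SameCyc z w = ∀ g → InCyc z g ⇔ InCyc w g

  HasSize : (Elt → Set) → ℕ → Set
  HasSize P k = ∃ λ (xs : List Elt) → Unique xs × length xs ≡ k × (∀ g → (g ∈ xs) ⇔ P g)

  -- induced cycle of length m = l + 4 (so every length ≥ 4 is covered):
  -- distinct vertices c 0 .. c (m-1), adjacent exactly when consecutive mod m
  InducedCycle : (l : ℕ) → Set
  InducedCycle l = Σ (Fin m → Elt) λ c → Injective _≡_ _≡_ c ×
    (∀ i j → Adj (c i) (c j) ⇔ ((toℕ j ≡ (suc (toℕ i)) % m) ⊎ (toℕ i ≡ (suc (toℕ j)) % m)))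
    where m = suc (suc (suc (suc l)))

  Chordal : Set
  Chordal = ∀ l → ¬ InducedCycle l

  InducedP4 : Elt → Elt → Elt → Elt → Set
  InducedP4 a b c d =
    a ≢ b × a ≢ c × a ≢ d × b ≢ c × b ≢ d × c ≢ d ×
    Adj a b × Adj b c × Adj c d × ¬ Adj a c × ¬ Adj a d × ¬ Adj b d

  Cograph : Set
  Cograph = ∀ a b c d → ¬ InducedP4 a b c d

module Submission where

-- If ⟨x, y⟩ and ⟨y, z⟩ are cyclic but ⟨x, z⟩ is not, then y is adjacent to every w. Put x, y
-- in a maximal cyclic subgroup M₁, y, z in M₂ and w in M₃; M₁ ≠ M₂, since otherwise x and z
-- would share a cyclic subgroup. If y ∉ M₃ then also M₁ ≠ M₃, so M₁ ∩ M₂ and M₁ ∩ M₃ are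
-- subgroups of the cyclic group M₁ of the same order k, hence equal; but y lies in the first
-- and not in the second. Hence the middle vertex of an induced path a - b - c is adjacent to
-- every vertex, which excludes both an induced P₄ and an induced cycle of length ≥ 4.

open import Defs
open import Algebra.Bundles using (Group)
import Algebra.Properties.Group as GroupProperties
open import Data.Empty using (⊥-elim)
open import Data.Fin as Fin using (Fin; toℕ; fromℕ<; #_)
open import Data.Fin.Properties using (pigeonhole; any?; toℕ-fromℕ<)
open import Data.Fin.Subset using (Subset; _⊃_) renaming (_∈_ to _∈ₛ_)
open import Data.Fin.Subset.Induction using (⊃-wellFounded)
open import Data.Integer using (+_; -[1+_])
open import Data.List using (List; length; applyUpTo)
import Data.List.Membership.DecPropositional as DecMembership
open import Data.List.Membership.Propositional using (_∈_)
open import Data.List.Membership.Propositional.Properties using (∈-applyUpTo⁺; ∈-applyUpTo⁻)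
open import Data.List.Membership.Propositional.Properties.WithK using (unique∧set⇒bag)
open import Data.List.Properties using (length-applyUpTo)
open import Data.List.Relation.Binary.BagAndSetEquality using (∼bag⇒↭)
open import Data.List.Relation.Binary.Permutation.Propositional.Properties using (↭-length)
open import Data.List.Relation.Unary.Unique.Propositional using (Unique)
open import Data.List.Relation.Unary.Unique.Propositional.Properties using (applyUpTo⁺₁)
open import Data.Nat using (ℕ; zero; suc; _+_; _*_; _∸_; _<_; _≤_; _%_; _/_; NonZero; >-nonZero; _<?_; _≟_)
open import Data.Nat.DivMod using (m≡m%n+[m/n]*n; m%n<n)
open import Data.Nat.Divisibility using (_∣_; divides; n∣m*n; m%n≡0⇒n∣m)
open import Data.Nat.GCD using (module GCD; module Bézout)
open import Data.Nat.Induction using (<-rec)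
open import Data.Nat.Properties
  using (anyUpTo?; n<1+n; <⇒≤; <⇒≢; ≤-<-trans; m∸n≤m; m<n⇒0<n∸m; m+[n∸m]≡n; m≤m*n;
         n≢0⇒n>0; *-monoˡ-<; *-cancelʳ-<; *-cancelˡ-≡)
open import Data.Product using (∃; _×_; _,_; proj₁; proj₂)
open import Data.Sum using (_⊎_; inj₁; inj₂)
open import Data.Vec using (tabulate)
open import Data.Vec.Properties using (lookup∘tabulate; lookup⇒[]=; []=⇒lookup)
open import Function using (_∘_)
open import Function.Bundles using (_⇔_; mk⇔; Equivalence)
open import Induction.WellFounded using (WellFounded; module Subrelation; module All)
open import Level using (0ℓ)
import Relation.Binary.Construct.On as On
open import Relation.Binary.PropositionalEquality
open import Relation.Nullary using (¬_; Dec; yes; no; does; proof; contradiction)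
open import Relation.Nullary.Reflects using (Reflects; invert)
open import Relation.Nullary.Decidable as Dec using (_×-dec_; ¬?; dec-true)
open import Relation.Unary using (Pred; Decidable)

open Equivalence using (to; from)

least-witness : {P : Pred ℕ 0ℓ} → Decidable P → ∃ P → ∃ λ m → P m × (∀ {j} → j < m → ¬ P j)
least-witness {P} P? (n , Pn) = <-rec (λ n → P n → Least) search n Pn
  where
  Least = ∃ λ m → P m × (∀ {j} → j < m → ¬ P j)
  search : ∀ n → (∀ {j} → j < n → P j → Least) → P n → Least
  search n smaller Pn with anyUpTo? P? n
  ... | yes (j , j<n , Pj) = smaller j<n Pj
  ... | no none = n , Pn , λ j<n Pj → none (_ , j<n , Pj)

sameMembers⇒sameLength : {A : Set} {xs ys : List A} → Unique xs → Unique ys →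
  (∀ x → x ∈ xs ⇔ x ∈ ys) → length xs ≡ length ys
sameMembers⇒sameLength xs! ys! xs≡ys = ↭-length (∼bag⇒↭ (unique∧set⇒bag xs! ys! (λ {x} → xs≡ys x)))

module _ (G : FiniteGroup) where
  open FiniteGroup G
  open DecMembership (Fin._≟_ {order}) using (_∈?_)

  group : Group 0ℓ 0ℓ
  group = record
    { Carrier = Elt G ; _≈_ = _≡_ ; _∙_ = _∙_ ; ε = e ; _⁻¹ = _⁻¹ ; isGroup = isGroup }

  open Group group using (assoc; identityˡ; identityʳ)
  open GroupProperties group using (∙-cancelˡ; x≈z//y; inverseʳ-unique)

  powℕ-+ : ∀ z i j → powℕ G z (i + j) ≡ powℕ G z i ∙ powℕ G z j
  powℕ-+ z zero j = sym (identityˡ _)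
  powℕ-+ z (suc i) j = trans (cong (z ∙_) (powℕ-+ z i j)) (sym (assoc z _ _))

  powℕ-* : ∀ z i j → powℕ G (powℕ G z i) j ≡ powℕ G z (j * i)
  powℕ-* z i zero = refl
  powℕ-* z i (suc j) = trans (cong (powℕ G z i ∙_) (powℕ-* z i j)) (sym (powℕ-+ z i (j * i)))

  powℕ-e : ∀ i → powℕ G e i ≡ e
  powℕ-e zero = refl
  powℕ-e (suc i) = trans (identityˡ _) (powℕ-e i)

  powℕ-∸ : ∀ z {i j} → i ≤ j → powℕ G z i ≡ powℕ G z j → powℕ G z (j ∸ i) ≡ e
  powℕ-∸ z {i} {j} i≤j zⁱ≡zʲ = ∙-cancelˡ (powℕ G z i) _ _ (begin
    powℕ G z i ∙ powℕ G z (j ∸ i)  ≡⟨ powℕ-+ z i (j ∸ i) ⟨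
    powℕ G z (i + (j ∸ i))         ≡⟨ cong (powℕ G z) (m+[n∸m]≡n i≤j) ⟩
    powℕ G z j                     ≡⟨ zⁱ≡zʲ ⟨
    powℕ G z i                     ≡⟨ identityʳ _ ⟨
    powℕ G z i ∙ e                 ∎)
    where open ≡-Reasoning

  IsPeriod : Elt G → ℕ → Set
  IsPeriod z j = 0 < j × powℕ G z j ≡ e

  period-exists : ∀ z → ∃ (IsPeriod z)
  period-exists z with i , j , i<j , zⁱ≡zʲ ← pigeonhole (n<1+n order) (λ i → powℕ G z (toℕ i))
    = toℕ j ∸ toℕ i , m<n⇒0<n∸m i<j , powℕ-∸ z (<⇒≤ i<j) zⁱ≡zʲ

  -- Abstract: letting Agda unfold the search makes type checking exhaust memory.
  abstract
    least-period : ∀ z → ∃ λ n → IsPeriod z n × (∀ {j} → j < n → ¬ IsPeriod z j)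
    least-period z = least-witness (λ j → 0 <? j ×-dec powℕ G z j Fin.≟ e) (period-exists z)

  ord : Elt G → ℕ
  ord z = proj₁ (least-period z)

  ord-positive : ∀ z → 0 < ord z
  ord-positive z = proj₁ (proj₁ (proj₂ (least-period z)))

  powℕ-ord : ∀ z → powℕ G z (ord z) ≡ e
  powℕ-ord z = proj₂ (proj₁ (proj₂ (least-period z)))

  ord-minimal : ∀ z {j} → j < ord z → ¬ IsPeriod z j
  ord-minimal z = proj₂ (proj₂ (least-period z))

  instance
    ord-nonZero : ∀ {z} → NonZero (ord z)
    ord-nonZero {z} = >-nonZero (ord-positive z)

  powℕ-*ord : ∀ z q → powℕ G z (q * ord z) ≡ e
  powℕ-*ord z q = begin
    powℕ G z (q * ord z)      ≡⟨ powℕ-* z (ord z) q ⟨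
    powℕ G (powℕ G z (ord z)) q ≡⟨ cong (λ u → powℕ G u q) (powℕ-ord z) ⟩
    powℕ G e q                ≡⟨ powℕ-e q ⟩
    e                         ∎
    where open ≡-Reasoning

  powℕ-mod : ∀ z i → powℕ G z i ≡ powℕ G z (i % ord z)
  powℕ-mod z i = begin
    powℕ G z i                                          ≡⟨ cong (powℕ G z) (m≡m%n+[m/n]*n i (ord z)) ⟩
    powℕ G z (i % ord z + i / ord z * ord z)            ≡⟨ powℕ-+ z (i % ord z) _ ⟩
    powℕ G z (i % ord z) ∙ powℕ G z (i / ord z * ord z) ≡⟨ cong (powℕ G z (i % ord z) ∙_) (powℕ-*ord z (i / ord z)) ⟩
    powℕ G z (i % ord z) ∙ e                            ≡⟨ identityʳ _ ⟩
    powℕ G z (i % ord z)                                ∎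
    where open ≡-Reasoning

  powℕ-⁻¹ : ∀ z i → powℕ G z i ⁻¹ ≡ powℕ G z (i * ord z ∸ i)
  powℕ-⁻¹ z i = sym (inverseʳ-unique _ _ (begin
    powℕ G z i ∙ powℕ G z (i * ord z ∸ i) ≡⟨ powℕ-+ z i _ ⟨
    powℕ G z (i + (i * ord z ∸ i))        ≡⟨ cong (powℕ G z) (m+[n∸m]≡n (m≤m*n i (ord z))) ⟩
    powℕ G z (i * ord z)                  ≡⟨ powℕ-*ord z i ⟩
    e                                     ∎))
    where open ≡-Reasoning

  powℕ-distinct : ∀ z {i j} → i < j → j < ord z → powℕ G z i ≢ powℕ G z j
  powℕ-distinct z {i} {j} i<j j<ord zⁱ≡zʲ =
    ord-minimal z (≤-<-trans (m∸n≤m j i) j<ord) (m<n⇒0<n∸m i<j , powℕ-∸ z (<⇒≤ i<j) zⁱ≡zʲ)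

  InCyc⇒powℕ : ∀ {z g} → InCyc G z g → ∃ λ i → i < ord z × g ≡ powℕ G z i
  InCyc⇒powℕ {z} (m , refl) = reduce (natural m)
    where
    reduce : ∀ {g} → ∃ (λ i → g ≡ powℕ G z i) → ∃ λ i → i < ord z × g ≡ powℕ G z i
    reduce (i , g≡zⁱ) = i % ord z , m%n<n i (ord z) , trans g≡zⁱ (powℕ-mod z i)

    natural : ∀ m → ∃ λ i → pow G z m ≡ powℕ G z i
    natural (+ i) = i , refl
    natural -[1+ i ] = suc i * ord z ∸ suc i , powℕ-⁻¹ z (suc i)

  InCyc-powℕ : ∀ z i → InCyc G z (powℕ G z i)
  InCyc-powℕ z i = + i , refl

  InCyc-refl : ∀ {z} → InCyc G z z
  InCyc-refl {z} = + 1 , sym (identityʳ z)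

  InCyc? : ∀ z g → Dec (InCyc G z g)
  InCyc? z g = Dec.map′ (λ (i , g≡zⁱ) → + toℕ i , g≡zⁱ) reduced
    (any? (λ (i : Fin (ord z)) → g Fin.≟ powℕ G z (toℕ i)))
    where
    reduced : InCyc G z g → ∃ λ (i : Fin (ord z)) → g ≡ powℕ G z (toℕ i)
    reduced g∈⟨z⟩ with i , i<ord , g≡zⁱ ← InCyc⇒powℕ g∈⟨z⟩ =
      fromℕ< i<ord , trans g≡zⁱ (cong (powℕ G z) (sym (toℕ-fromℕ< i<ord)))

  record IsSubgroup (H : Elt G → Set) : Set where
    field
      e-closed : H e
      ∙-closed : ∀ {g h} → H g → H h → H (g ∙ h)
      ⁻¹-closed : ∀ {g} → H g → H (g ⁻¹)

    powℕ-closed : ∀ {g} i → H g → H (powℕ G g i)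
    powℕ-closed zero _ = e-closed
    powℕ-closed (suc i) h = ∙-closed h (powℕ-closed i h)

  open IsSubgroup

  InCyc-least : ∀ {H z g} → IsSubgroup H → H z → InCyc G z g → H g
  InCyc-least H-sub z∈H g∈⟨z⟩ with i , _ , refl ← InCyc⇒powℕ g∈⟨z⟩ = powℕ-closed H-sub i z∈H

  InGen2-least : ∀ {H x y g} → IsSubgroup H → H x → H y → InGen2 G x y g → H g
  InGen2-least H-sub x∈H y∈H gen-e = e-closed H-sub
  InGen2-least H-sub x∈H y∈H gen-x = x∈H
  InGen2-least H-sub x∈H y∈H gen-y = y∈H
  InGen2-least H-sub x∈H y∈H (gen-inv g) = ⁻¹-closed H-sub (InGen2-least H-sub x∈H y∈H g)
  InGen2-least H-sub x∈H y∈H (gen-mul g h) =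
    ∙-closed H-sub (InGen2-least H-sub x∈H y∈H g) (InGen2-least H-sub x∈H y∈H h)

  InGen2-isSubgroup : ∀ {x y} → IsSubgroup (InGen2 G x y)
  InGen2-isSubgroup = record { e-closed = gen-e ; ∙-closed = gen-mul ; ⁻¹-closed = gen-inv }

  InCyc-isSubgroup : ∀ z → IsSubgroup (InCyc G z)
  InCyc-isSubgroup z = record
    { e-closed = InCyc-powℕ z 0
    ; ∙-closed = λ g∈ h∈ → product (InCyc⇒powℕ g∈) (InCyc⇒powℕ h∈)
    ; ⁻¹-closed = λ g∈ → inverse (InCyc⇒powℕ g∈)
    }
    where
    product : ∀ {g h} → ∃ (λ i → _ × g ≡ powℕ G z i) → ∃ (λ j → _ × h ≡ powℕ G z j) → InCyc G z (g ∙ h)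
    product (i , _ , refl) (j , _ , refl) = + (i + j) , sym (powℕ-+ z i j)
    inverse : ∀ {g} → ∃ (λ i → _ × g ≡ powℕ G z i) → InCyc G z (g ⁻¹)
    inverse (i , _ , refl) = + (i * ord z ∸ i) , powℕ-⁻¹ z i

  ∩-isSubgroup : ∀ {H₁ H₂} → IsSubgroup H₁ → IsSubgroup H₂ → IsSubgroup (λ g → H₁ g × H₂ g)
  ∩-isSubgroup H₁-sub H₂-sub = record
    { e-closed = e-closed H₁-sub , e-closed H₂-sub
    ; ∙-closed = λ (g₁ , g₂) (h₁ , h₂) → ∙-closed H₁-sub g₁ h₁ , ∙-closed H₂-sub g₂ h₂
    ; ⁻¹-closed = λ (g₁ , g₂) → ⁻¹-closed H₁-sub g₁ , ⁻¹-closed H₂-sub g₂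
    }

  InCyc-trans : ∀ {w z g} → InCyc G w z → InCyc G z g → InCyc G w g
  InCyc-trans {w} = InCyc-least (InCyc-isSubgroup w)

  -- ⟨mᵃ, mᵇ⟩ is generated by m^gcd(a,b), which lies in it by Bézout.
  powℕ-Gen2Cyclic : ∀ m a b → Gen2Cyclic G (powℕ G m a) (powℕ G m b)
  powℕ-Gen2Cyclic m a b with Bézout.lemma a b
  ... | Bézout.result d gcd bezout = powℕ G m d , λ g → mk⇔
    (InGen2-least (InCyc-isSubgroup _) (dividing (proj₁ (GCD.commonDivisor gcd))) (dividing (proj₂ (GCD.commonDivisor gcd))))
    (InCyc-least InGen2-isSubgroup (generator bezout))
    where
    ⟨mᵃ,mᵇ⟩ : Elt G → Set
    ⟨mᵃ,mᵇ⟩ = InGen2 G (powℕ G m a) (powℕ G m b)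

    dividing : ∀ {c} → d ∣ c → InCyc G (powℕ G m d) (powℕ G m c)
    dividing (divides q refl) = + q , sym (powℕ-* m d q)

    multiple : ∀ {c} q → ⟨mᵃ,mᵇ⟩ (powℕ G m c) → ⟨mᵃ,mᵇ⟩ (powℕ G m (q * c))
    multiple {c} q mᶜ∈ = subst ⟨mᵃ,mᵇ⟩ (powℕ-* m c q) (powℕ-closed InGen2-isSubgroup q mᶜ∈)

    quotient : ∀ {r s} → d + s ≡ r → ⟨mᵃ,mᵇ⟩ (powℕ G m r) → ⟨mᵃ,mᵇ⟩ (powℕ G m s) → ⟨mᵃ,mᵇ⟩ (powℕ G m d)
    quotient {r} {s} d+s≡r mʳ∈ mˢ∈ =
      subst ⟨mᵃ,mᵇ⟩ (sym (x≈z//y _ _ _ (trans (sym (powℕ-+ m d s)) (cong (powℕ G m) d+s≡r))))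
        (∙-closed InGen2-isSubgroup mʳ∈ (gen-inv mˢ∈))

    generator : Bézout.Identity d a b → ⟨mᵃ,mᵇ⟩ (powℕ G m d)
    generator (Bézout.+- s t eq) = quotient eq (multiple s gen-x) (multiple t gen-y)
    generator (Bézout.-+ s t eq) = quotient eq (multiple t gen-y) (multiple s gen-x)

  InCyc⇒Gen2Cyclic : ∀ {m x y} → InCyc G m x → InCyc G m y → Gen2Cyclic G x y
  InCyc⇒Gen2Cyclic {m} x∈ y∈ with a , _ , refl ← InCyc⇒powℕ x∈ | b , _ , refl ← InCyc⇒powℕ y∈ =
    powℕ-Gen2Cyclic m a b

  cyclicSubset : Elt G → Subset order
  cyclicSubset z = tabulate (λ g → does (InCyc? z g))

  ∈-cyclicSubset⁺ : ∀ {z g} → InCyc G z g → g ∈ₛ cyclicSubset z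
  ∈-cyclicSubset⁺ {z} {g} g∈⟨z⟩ =
    lookup⇒[]= g _ (trans (lookup∘tabulate _ g) (dec-true (InCyc? z g) g∈⟨z⟩))

  ∈-cyclicSubset⁻ : ∀ {z g} → g ∈ₛ cyclicSubset z → InCyc G z g
  ∈-cyclicSubset⁻ {z} {g} g∈ =
    invert (subst (Reflects _) (trans (sym (lookup∘tabulate _ g)) ([]=⇒lookup g∈)) (proof (InCyc? z g)))

  _⊐_ : Elt G → Elt G → Set
  w ⊐ z = InCyc G w z × ¬ InCyc G z w

  ⊐-wellFounded : WellFounded _⊐_
  ⊐-wellFounded = Subrelation.wellFounded ⊐⇒⊃ (On.wellFounded cyclicSubset ⊃-wellFounded)
    where
    ⊐⇒⊃ : ∀ {w z} → w ⊐ z → cyclicSubset w ⊃ cyclicSubset z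
    ⊐⇒⊃ (z∈⟨w⟩ , w∉⟨z⟩) =
      (λ g∈ → ∈-cyclicSubset⁺ (InCyc-trans z∈⟨w⟩ (∈-cyclicSubset⁻ g∈))) ,
      _ , ∈-cyclicSubset⁺ InCyc-refl , w∉⟨z⟩ ∘ ∈-cyclicSubset⁻

  maximal-cyclic-above : ∀ z → ∃ λ M → MaxCyclic G M × InCyc G M z
  maximal-cyclic-above = All.wfRec ⊐-wellFounded 0ℓ _ climb
    where
    climb : ∀ z → (∀ {w} → w ⊐ z → ∃ λ M → MaxCyclic G M × InCyc G M w) → ∃ λ M → MaxCyclic G M × InCyc G M z
    climb z above with any? (λ w → InCyc? w z ×-dec ¬? (InCyc? z w))
    ... | yes (w , w⊐z) with M , M-max , w∈⟨M⟩ ← above w⊐z = M , M-max , InCyc-trans w∈⟨M⟩ (proj₁ w⊐z)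
    ... | no nothing-above = z , z-max , InCyc-refl
      where
      z-max : MaxCyclic G z
      z-max w ⟨z⟩⊆⟨w⟩ g g∈⟨w⟩ with InCyc? z w
      ... | yes w∈⟨z⟩ = InCyc-trans w∈⟨z⟩ g∈⟨w⟩
      ... | no w∉⟨z⟩ = ⊥-elim (nothing-above (w , ⟨z⟩⊆⟨w⟩ z InCyc-refl , w∉⟨z⟩))

  Gen2Cyclic⇒maximal : ∀ {x y} → Gen2Cyclic G x y → ∃ λ M → MaxCyclic G M × InCyc G M x × InCyc G M y
  Gen2Cyclic⇒maximal (u , ⟨x,y⟩≡⟨u⟩) with M , M-max , u∈⟨M⟩ ← maximal-cyclic-above u =
    M , M-max , InCyc-trans u∈⟨M⟩ (to (⟨x,y⟩≡⟨u⟩ _) gen-x) , InCyc-trans u∈⟨M⟩ (to (⟨x,y⟩≡⟨u⟩ _) gen-y)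

  HasSize⇒Decidable : ∀ {P k} → HasSize G P k → Decidable P
  HasSize⇒Decidable (xs , _ , _ , xs≡P) g = Dec.map (xs≡P g) (g ∈? xs)

  -- H = ⟨m ^ index⟩ for the least positive exponent `index` with m ^ index ∈ H; counting the
  -- multiples of index below ord m then gives |H| · index = ord m.
  module CyclicSubgroup {m : Elt G} {H : Elt G → Set}
    (H-sub : IsSubgroup H) (H⊆⟨m⟩ : ∀ {g} → H g → InCyc G m g) (H? : Decidable H) where

    least-exponent : ∃ λ d → (0 < d × H (powℕ G m d)) × (∀ {j} → j < d → ¬ (0 < j × H (powℕ G m j)))
    least-exponent = least-witness (λ j → 0 <? j ×-dec H? (powℕ G m j))
      (ord m , ord-positive m , subst H (sym (powℕ-ord m)) (e-closed H-sub))

    index : ℕ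
    index = proj₁ least-exponent

    instance
      index-nonZero : NonZero index
      index-nonZero = >-nonZero (proj₁ (proj₁ (proj₂ least-exponent)))

    ∣index⇒∈ : ∀ {i} → index ∣ i → H (powℕ G m i)
    ∣index⇒∈ (divides q refl) = subst H (powℕ-* m index q) (powℕ-closed H-sub q (proj₂ (proj₁ (proj₂ least-exponent))))

    ∈⇒∣index : ∀ i → H (powℕ G m i) → index ∣ i
    ∈⇒∣index i mⁱ∈H = m%n≡0⇒n∣m i index remainder≡0
      where
      r = i % index
      q = i / index

      mⁱ≡mʳ∙mᑫⁱ : powℕ G m i ≡ powℕ G m r ∙ powℕ G m (q * index)
      mⁱ≡mʳ∙mᑫⁱ = trans (cong (powℕ G m) (m≡m%n+[m/n]*n i index)) (powℕ-+ m r (q * index))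

      mʳ∈H : H (powℕ G m r)
      mʳ∈H = subst H (sym (x≈z//y _ _ _ (sym mⁱ≡mʳ∙mᑫⁱ)))
        (∙-closed H-sub mⁱ∈H (⁻¹-closed H-sub (∣index⇒∈ (n∣m*n q))))

      remainder≡0 : r ≡ 0
      remainder≡0 with r ≟ 0
      ... | yes r≡0 = r≡0
      ... | no r≢0 = ⊥-elim (proj₂ (proj₂ least-exponent) (m%n<n i index) (n≢0⇒n>0 r≢0 , mʳ∈H))

    size*index≡ord : ∀ {k} → HasSize G H k → k * index ≡ ord m
    size*index≡ord (xs , xs! , refl , xs≡H)
      with divides c ord≡c*index ← ∈⇒∣index (ord m) (subst H (sym (powℕ-ord m)) (e-closed H-sub)) =
      begin
        length xs * index               ≡⟨ cong (_* index) (sameMembers⇒sameLength xs! multiples! xs≡multiples) ⟩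
        length multiples * index        ≡⟨ cong (_* index) (length-applyUpTo _ c) ⟩
        c * index                       ≡⟨ ord≡c*index ⟨
        ord m                           ∎
      where
      open ≡-Reasoning
      multiples : List (Elt G)
      multiples = applyUpTo (λ q → powℕ G m (q * index)) c

      below-ord : ∀ {q} → q < c → q * index < ord m
      below-ord {q} q<c = subst (q * index <_) (sym ord≡c*index) (*-monoˡ-< index q<c)

      multiples! : Unique multiples
      multiples! = applyUpTo⁺₁ _ c λ p<q q<c mᵖⁱ≡mᑫⁱ →
        powℕ-distinct m (*-monoˡ-< index p<q) (below-ord q<c) mᵖⁱ≡mᑫⁱ

      xs≡multiples : ∀ g → g ∈ xs ⇔ g ∈ multiples
      xs≡multiples g = mk⇔ (into ∘ to (xs≡H g)) (from (xs≡H g) ∘ out)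
        where
        into : H g → g ∈ multiples
        into g∈H with i , i<ord , refl ← InCyc⇒powℕ (H⊆⟨m⟩ g∈H) = multiple i<ord (∈⇒∣index i g∈H)
          where
          multiple : ∀ {i} → i < ord m → index ∣ i → powℕ G m i ∈ multiples
          multiple i<ord (divides q refl) =
            ∈-applyUpTo⁺ (λ q → powℕ G m (q * index)) (*-cancelʳ-< index q c (subst (q * index <_) ord≡c*index i<ord))
        out : g ∈ multiples → H g
        out g∈ with q , _ , refl ← ∈-applyUpTo⁻ _ g∈ = ∣index⇒∈ (n∣m*n q)

  same-size-subgroups : ∀ {m H₁ H₂ k} → IsSubgroup H₁ → IsSubgroup H₂ →
    (∀ {g} → H₁ g → InCyc G m g) → (∀ {g} → H₂ g → InCyc G m g) →
    HasSize G H₁ k → HasSize G H₂ k → ∀ {g} → H₁ g → H₂ g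
  same-size-subgroups {m} {k = k} H₁-sub H₂-sub H₁⊆⟨m⟩ H₂⊆⟨m⟩ |H₁|≡k |H₂|≡k g∈H₁
    with i , _ , refl ← InCyc⇒powℕ (H₁⊆⟨m⟩ g∈H₁) =
    C₂.∣index⇒∈ (subst (_∣ i) same-index (C₁.∈⇒∣index i g∈H₁))
    where
    module C₁ = CyclicSubgroup H₁-sub H₁⊆⟨m⟩ (HasSize⇒Decidable |H₁|≡k)
    module C₂ = CyclicSubgroup H₂-sub H₂⊆⟨m⟩ (HasSize⇒Decidable |H₂|≡k)

    same-index : C₁.index ≡ C₂.index
    same-index = cancel k (C₁.size*index≡ord |H₁|≡k) (C₂.size*index≡ord |H₂|≡k)
      where
      cancel : ∀ k → k * C₁.index ≡ ord m → k * C₂.index ≡ ord m → C₁.index ≡ C₂.index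
      cancel zero 0≡ord _ = contradiction 0≡ord (<⇒≢ (ord-positive m))
      cancel (suc k) k*i₁≡ord k*i₂≡ord = *-cancelˡ-≡ _ _ (suc k) (trans k*i₁≡ord (sym k*i₂≡ord))

1,3-nonconsecutive : ∀ l → ¬ (3 ≡ 2 % (4 + l) ⊎ 1 ≡ 4 % (4 + l))
1,3-nonconsecutive _ (inj₁ ())
1,3-nonconsecutive zero (inj₂ ())
1,3-nonconsecutive (suc _) (inj₂ ())

module _ {G : FiniteGroup} {k : ℕ}
  (uniform : ∀ z w → MaxCyclic G z → MaxCyclic G w → ¬ SameCyc G z w →
    HasSize G (λ g → InCyc G z g × InCyc G w g) k) where

  midpoint-dominates : ∀ {x y z} → Gen2Cyclic G x y → Gen2Cyclic G y z → ¬ Gen2Cyclic G x z →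
    ∀ w → Gen2Cyclic G y w
  midpoint-dominates {x} {y} {z} xy yz ¬xz w
    with M₁ , M₁-max , x∈⟨M₁⟩ , y∈⟨M₁⟩ ← Gen2Cyclic⇒maximal G xy
       | M₂ , M₂-max , y∈⟨M₂⟩ , z∈⟨M₂⟩ ← Gen2Cyclic⇒maximal G yz
       | M₃ , M₃-max , w∈⟨M₃⟩ ← maximal-cyclic-above G w
       | InCyc? G M₃ y
  ... | yes y∈⟨M₃⟩ = InCyc⇒Gen2Cyclic G y∈⟨M₃⟩ w∈⟨M₃⟩
  ... | no y∉⟨M₃⟩ = ⊥-elim (y∉⟨M₃⟩ (proj₂ (same-size-subgroups G
        (∩-isSubgroup G (InCyc-isSubgroup G M₁) (InCyc-isSubgroup G M₂))
        (∩-isSubgroup G (InCyc-isSubgroup G M₁) (InCyc-isSubgroup G M₃))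
        proj₁ proj₁ (uniform M₁ M₂ M₁-max M₂-max M₁≢M₂) (uniform M₁ M₃ M₁-max M₃-max M₁≢M₃)
        (y∈⟨M₁⟩ , y∈⟨M₂⟩))))
    where
    M₁≢M₂ : ¬ SameCyc G M₁ M₂
    M₁≢M₂ M₁≡M₂ = ¬xz (InCyc⇒Gen2Cyclic G x∈⟨M₁⟩ (from (M₁≡M₂ z) z∈⟨M₂⟩))
    M₁≢M₃ : ¬ SameCyc G M₁ M₃
    M₁≢M₃ M₁≡M₃ = y∉⟨M₃⟩ (to (M₁≡M₃ y) y∈⟨M₁⟩)

  Adj-midpoint : ∀ {a b c d} → Adj G a b → Adj G b c → a ≢ c → ¬ Adj G a c → b ≢ d → Adj G b d
  Adj-midpoint (_ , ab) (_ , bc) a≢c ¬ac b≢d = b≢d , midpoint-dominates ab bc (λ ac → ¬ac (a≢c , ac)) _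

  chordal : Chordal G
  chordal l (c , c-injective , adjacency) =
    ¬adj₁₃ (Adj-midpoint (adjacent (# 0) (# 1) refl) (adjacent (# 1) (# 2) refl)
                         (distinct (# 0) (# 2) λ ()) ¬adj₀₂ (distinct (# 1) (# 3) λ ()))
    where
    adjacent : ∀ i j → toℕ j ≡ suc (toℕ i) % suc (suc (suc (suc l))) → Adj G (c i) (c j)
    adjacent i j j≡i+1 = from (adjacency i j) (inj₁ j≡i+1)
    distinct : ∀ i j → i ≢ j → c i ≢ c j
    distinct i j i≢j = i≢j ∘ c-injective
    ¬adj₀₂ : ¬ Adj G (c (# 0)) (c (# 2))
    ¬adj₀₂ a with to (adjacency (# 0) (# 2)) a
    ... | inj₁ ()
    ... | inj₂ ()
    ¬adj₁₃ : ¬ Adj G (c (# 1)) (c (# 3))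
    ¬adj₁₃ = 1,3-nonconsecutive l ∘ to (adjacency (# 1) (# 3))

  cograph : Cograph G
  cograph a b c d (_ , a≢c , _ , _ , b≢d , _ , ab , bc , _ , ¬ac , _ , ¬bd) = ¬bd (Adj-midpoint ab bc a≢c ¬ac b≢d)

proposition4p6 : (G : FiniteGroup) (k : ℕ) →
    (∀ z w → MaxCyclic G z → MaxCyclic G w → ¬ SameCyc G z w →
      HasSize G (λ g → InCyc G z g × InCyc G w g) k) →
    Chordal G × Cograph G
proposition4p6 G k uniform = chordal uniform , cograph uniform
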